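{- Let $G$ be a partial cube with ${\rm idim}(G)=k$. Then ${\rm fdim}(G)=2k-1$ if and only if the crossing graph $G^{\#}$ is the complete graph $K_k$.
   Context: All graphs are finite. The $d$-cube $Q_d$ has vertex set $\{0,1\}^d$, two vertices adjacent iff they differ in exactly one coordinate. A Fibonacci string is a binary string with no two consecutive $1$s; the Fibonacci cube $\Gamma_d$ is the subgraph of $Q_d$ induced by the Fibonacci strings of length $d$. A partial cube is a graph admitting a distance-preserving injective map into some hypercube; ${\rm idim}(G)$ (resp. ${\rm fdim}(G)$) is the least $k$ such that $G$ admits a distance-preserving injective map into $Q_k$ (resp. $\Gamma_k$). For a partial cube $G$ with $k={\rm idim}(G)$, fix a distance-preserving map $\beta:V(G)\to V(Q_k)$ and define semicubes $W_{(i,\chi)}=\{u\in V(G)\mid \beta^{(i)}(u)=\chi\}$ for $(i,\chi)\in[k]\times\{0,1\}$. The $\Theta$-class of index $i$ is the set of edges with one end in $W_{(i,0)}$ and the other in $W_{(i,1)}$. The crossing graph $G^{\#}$ has the $k$ $\Theta$-classes (equivalently, the indices $i\in[k]$) as nodes, with $i\neq j$ adjacent iff the four sets $W_{(i,0)}\cap W_{(j,0)}$, $W_{(i,0)}\cap W_{(j,1)}$, $W_{(i,1)}\cap W_{(j,0)}$, $W_{(i,1)}\cap W_{(j,1)}$ are all nonempty. -}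

module Defs where

open import Data.Nat using (ℕ; zero; suc; _≤_)
open import Data.Fin using (Fin)
open import Data.Vec using (Vec; []; _∷_; lookup)
open import Data.Bool using (Bool; true; false)
open import Data.Product using (Σ; ∃; _×_; _,_; proj₁)
open import Data.Unit using (⊤)
open import Data.Empty using (⊥)
open import Relation.Nullary using (¬_)
open import Relation.Binary.PropositionalEquality using (_≡_; _≢_)
open import Function.Definitions using (Injective)
open import Function.Bundles using (_⇔_)

record Graph : Set₁ where
  field
    V : Set
    E : V → V → Set
open Graph public

record FiniteSimpleGraph (n : ℕ) : Set₁ where
  field
    Adj       : Fin n → Fin n → Set
    Adj-sym   : ∀ {u v} → Adj u v → Adj v u
    Adj-irrefl : ∀ {u} → ¬ Adj u u
open FiniteSimpleGraph public

toGraph : ∀ {n} → FiniteSimpleGraph n → Graph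
toGraph {n} G = record { V = Fin n ; E = Adj G }

data Walk (G : Graph) : V G → V G → ℕ → Set where
  here : ∀ {u} → Walk G u u zero
  step : ∀ {u v w m} → E G u v → Walk G v w m → Walk G u w (suc m)

Dist : (G : Graph) → V G → V G → ℕ → Set
Dist G u v m = Walk G u v m × (∀ m′ → Walk G u v m′ → m ≤ m′)

DistancePreserving : (G H : Graph) → (V G → V H) → Set
DistancePreserving G H f = ∀ u v m → Dist G u v m ⇔ Dist H (f u) (f v) m

IsometricEmbedding : (G H : Graph) → Set
IsometricEmbedding G H =
  Σ (V G → V H) λ f → Injective _≡_ _≡_ f × DistancePreserving G H f

DifferInOne : ∀ {d} → Vec Bool d → Vec Bool d → Set
DifferInOne {d} x y =
  Σ (Fin d) λ i → lookup x i ≢ lookup y i × (∀ j → j ≢ i → lookup x j ≡ lookup y j)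

Q : ℕ → Graph
Q d = record { V = Vec Bool d ; E = DifferInOne }

-- Fibonacci strings: no two consecutive 1s (true = 1)
Fibonacci : ∀ {d} → Vec Bool d → Set
Fibonacci [] = ⊤
Fibonacci (false ∷ xs) = Fibonacci xs
Fibonacci (true ∷ []) = ⊤
Fibonacci (true ∷ false ∷ xs) = Fibonacci (false ∷ xs)
Fibonacci (true ∷ true ∷ xs) = ⊥

Γ : ℕ → Graph
Γ d = record { V = Σ (Vec Bool d) Fibonacci
             ; E = λ x y → DifferInOne (proj₁ x) (proj₁ y) }

PartialCube : Graph → Set
PartialCube G = ∃ λ k → IsometricEmbedding G (Q k)

IsIdim : Graph → ℕ → Set
IsIdim G k = IsometricEmbedding G (Q k) × (∀ j → IsometricEmbedding G (Q j) → k ≤ j)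

IsFdim : Graph → ℕ → Set
IsFdim G k = IsometricEmbedding G (Γ k) × (∀ j → IsometricEmbedding G (Γ j) → k ≤ j)

InSemicube : ∀ {A : Set} {k} → (A → Vec Bool k) → Fin k → Bool → A → Set
InSemicube β i χ u = lookup (β u) i ≡ χ

-- adjacency in the crossing graph G^# (nodes = indices in Fin k)
Crossing : ∀ {A : Set} {k} → (A → Vec Bool k) → Fin k → Fin k → Set
Crossing β i j =
  i ≢ j
  × (∃ λ u → InSemicube β i false u × InSemicube β j false u)
  × (∃ λ u → InSemicube β i false u × InSemicube β j true u)
  × (∃ λ u → InSemicube β i true u × InSemicube β j false u)
  × (∃ λ u → InSemicube β i true u × InSemicube β j true u)

CrossingGraphComplete : ∀ {A : Set} {k} → (A → Vec Bool k) → Set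
CrossingGraphComplete {k = k} β = ∀ (i j : Fin k) → i ≢ j → Crossing β i j

module Submission where

-- Everything is reduced to Hamming distance: distances in Q_d and in the
-- Fibonacci cube Γ_d are Hamming distances (both graphs have geodesics that
-- flip one bit at a time), so an isometric embedding of G is the same as a map
-- g with hamming (g u) (g v) = hamming (β u) (β v).
--
-- (⇐) The string x ↦ x₀ 0 x₁ 0 … 0 x_{k−1} of length 2k − 1 is Fibonacci, so
-- fdim G ≤ 2k − 1.  Conversely, let F : G → Γ_j be isometric.  Minimality of k
-- makes every coordinate of β non-constant, so each Θ-class i is cut by an
-- edge; the same edge flips a single coordinate σ i of F, and coordinate σ i of
-- F equals coordinate i of β up to complementation.  If i and i′ cross, some
-- vertex has 1s at both σ i and σ i′, so σ is injective with no two values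
-- consecutive; such a σ : Fin k → Fin j forces 2k − 1 ≤ j.
-- (⇒) If i ≠ i′ do not cross, some quadrant W_(i,a) ∩ W_(i′,b) is empty; putting
-- the (suitably complemented) coordinates i, i′ first and padding the others
-- by 0s gives a Fibonacci embedding into Γ_{2k−2}, contradicting fdim = 2k − 1.

open import Defs
open import Data.Nat using (ℕ; zero; suc; _+_; _*_; _∸_; _≤_; _<_; z≤n; s≤s; ⌊_/2⌋; ⌈_/2⌉)
open import Data.Nat.Properties
  using (≤-refl; ≤-trans; ≤-antisym; ≤-reflexive; m≤n⇒m≤1+n; 1+n≰n; <-asym; +-suc; +-identityʳ;
         +-commutativeSemigroup; 0≢1+n; suc-injective; m+n≡0⇒m≡0; m+n≡0⇒n≡0; ⌊n/2⌋-mono;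
         module ≤-Reasoning)
open import Algebra.Properties.CommutativeSemigroup +-commutativeSemigroup using (x∙yz≈y∙xz)
open import Data.Fin using (Fin; zero; suc; toℕ; fromℕ<; punchOut)
open import Data.Fin.Properties using (any?; injective⇒≤; toℕ-injective; toℕ<n; toℕ-fromℕ<)
  renaming (_≟_ to _≟ᶠ_; suc-injective to suc-injectiveᶠ)
open import Data.Vec using (Vec; []; _∷_; lookup; removeAt; _[_]≔_)
open import Data.Vec.Properties
  using (lookup∘update; lookup∘update′; removeAt-punchOut; tabulate∘lookup; tabulate-cong)
open import Data.Bool using (Bool; true; false; not; _xor_)
open import Data.Bool.Properties
  using (xor-assoc; xor-same; xor-identityʳ; not-injective; ¬-not; not-¬; not-distribʳ-xor)
  renaming (_≟_ to _≟ᵇ_)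
open import Data.Product using (Σ; ∃; _×_; _,_; proj₁; proj₂)
open import Data.Sum using (_⊎_; inj₁; inj₂)
open import Data.Unit using (tt)
open import Data.Empty using (⊥; ⊥-elim)
open import Relation.Nullary using (¬_; yes; no)
open import Relation.Nullary.Decidable using (¬?; _×-dec_; decidable-stable)
open import Relation.Binary.PropositionalEquality
  using (_≡_; _≢_; refl; sym; trans; cong; cong₂; subst; subst₂; module ≡-Reasoning)
open import Function using (_∘_)
open import Function.Definitions using (Injective)
open import Function.Bundles using (_⇔_; mk⇔; Equivalence)
open import Function.Construct.Composition using (_⇔-∘_)
open import Function.Construct.Symmetry using (⇔-sym)

open Equivalence using (to; from)

bitDistance : Bool → Bool → ℕ
bitDistance false false = 0
bitDistance false true  = 1
bitDistance true  false = 1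
bitDistance true  true  = 0

hamming : ∀ {d} → Vec Bool d → Vec Bool d → ℕ
hamming []      []      = 0
hamming (a ∷ x) (b ∷ y) = bitDistance a b + hamming x y

bitDistance-self : ∀ a → bitDistance a a ≡ 0
bitDistance-self false = refl
bitDistance-self true  = refl

bitDistance-sym : ∀ a b → bitDistance a b ≡ bitDistance b a
bitDistance-sym false false = refl
bitDistance-sym false true  = refl
bitDistance-sym true  false = refl
bitDistance-sym true  true  = refl

bitDistance-≢ : ∀ {a b} → a ≢ b → bitDistance a b ≡ 1
bitDistance-≢ {false} {false} a≢b = ⊥-elim (a≢b refl)
bitDistance-≢ {false} {true}  _   = refl
bitDistance-≢ {true}  {false} _   = refl
bitDistance-≢ {true}  {true}  a≢b = ⊥-elim (a≢b refl)

bitDistance-zero : ∀ {a b} → bitDistance a b ≡ 0 → a ≡ b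
bitDistance-zero {false} {false} _ = refl
bitDistance-zero {true}  {true}  _ = refl

bitDistance-xor : ∀ o a b → bitDistance (o xor a) (o xor b) ≡ bitDistance a b
bitDistance-xor false a     b     = refl
bitDistance-xor true  false false = refl
bitDistance-xor true  false true  = refl
bitDistance-xor true  true  false = refl
bitDistance-xor true  true  true  = refl

xor-cancel : ∀ a b → (a xor b) xor b ≡ a
xor-cancel a b = trans (xor-assoc a b b) (trans (cong (a xor_) (xor-same b)) (xor-identityʳ a))

xor-injective : ∀ o {a b} → o xor a ≡ o xor b → a ≡ b
xor-injective false eq = eq
xor-injective true  eq = not-injective eq

xor-not-self : ∀ o → o xor not o ≡ true
xor-not-self false = refl
xor-not-self true  = refl

not-xor-true : ∀ a x → not a xor x ≡ true → x ≡ a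
not-xor-true false false _  = refl
not-xor-true false true  ()
not-xor-true true  false ()
not-xor-true true  true  _  = refl

aligned : ∀ {p p₀ q q₀ : Bool} → (p ≡ p₀ ⇔ q ≡ q₀) → q ≡ (q₀ xor p₀) xor p
aligned {p} {p₀} {q} {q₀} same with p ≟ᵇ p₀ | q ≟ᵇ q₀
... | yes refl  | yes refl  = sym (xor-cancel q₀ p)
... | yes p≡p₀  | no  q≢q₀  = ⊥-elim (q≢q₀ (to same p≡p₀))
... | no  p≢p₀  | yes q≡q₀  = ⊥-elim (p≢p₀ (from same q≡q₀))
... | no  p≢p₀  | no  q≢q₀  = begin
  q                          ≡⟨ ¬-not q≢q₀ ⟩
  not q₀                     ≡⟨ cong not (sym (xor-cancel q₀ p₀)) ⟩
  not ((q₀ xor p₀) xor p₀)   ≡⟨ not-distribʳ-xor (q₀ xor p₀) p₀ ⟩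
  (q₀ xor p₀) xor not p₀     ≡⟨ cong ((q₀ xor p₀) xor_) (sym (¬-not p≢p₀)) ⟩
  (q₀ xor p₀) xor p          ∎
  where open ≡-Reasoning

hamming-self : ∀ {d} (x : Vec Bool d) → hamming x x ≡ 0
hamming-self []      = refl
hamming-self (a ∷ x) = cong₂ _+_ (bitDistance-self a) (hamming-self x)

hamming-sym : ∀ {d} (x y : Vec Bool d) → hamming x y ≡ hamming y x
hamming-sym []      []      = refl
hamming-sym (a ∷ x) (b ∷ y) = cong₂ _+_ (bitDistance-sym a b) (hamming-sym x y)

hamming-zero : ∀ {d} {x y : Vec Bool d} → hamming x y ≡ 0 → x ≡ y
hamming-zero {x = []}    {[]}    _ = refl
hamming-zero {x = a ∷ x} {b ∷ y} h =
  cong₂ _∷_ (bitDistance-zero (m+n≡0⇒m≡0 _ h)) (hamming-zero (m+n≡0⇒n≡0 (bitDistance a b) h))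

vec-ext : ∀ {A : Set} {d} {x y : Vec A d} → (∀ i → lookup x i ≡ lookup y i) → x ≡ y
vec-ext {x = x} {y} same = trans (sym (tabulate∘lookup x)) (trans (tabulate-cong same) (tabulate∘lookup y))

differing-coordinate : ∀ {d} (x y : Vec Bool d) {n} → hamming x y ≡ suc n
  → ∃ λ i → lookup x i ≢ lookup y i
differing-coordinate x y h with any? (λ i → ¬? (lookup x i ≟ᵇ lookup y i))
... | yes found = found
... | no none   = ⊥-elim (0≢1+n (trans (sym (hamming-self x)) (trans (cong (hamming x) x≡y) h)))
  where
  x≡y : x ≡ y
  x≡y = vec-ext (λ i → decidable-stable (lookup x i ≟ᵇ lookup y i) (λ xᵢ≢yᵢ → none (i , xᵢ≢yᵢ)))

hamming-update : ∀ {d} (x y : Vec Bool d) i → lookup x i ≢ lookup y i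
  → suc (hamming (x [ i ]≔ lookup y i) y) ≡ hamming x y
hamming-update (a ∷ x) (b ∷ y) zero    a≢b
  rewrite bitDistance-self b | bitDistance-≢ a≢b = refl
hamming-update (a ∷ x) (b ∷ y) (suc i) xᵢ≢yᵢ =
  trans (sym (+-suc (bitDistance a b) _)) (cong (bitDistance a b +_) (hamming-update x y i xᵢ≢yᵢ))

update-differs : ∀ {d} (x : Vec Bool d) i b → lookup x i ≢ b → DifferInOne x (x [ i ]≔ b)
update-differs x i b xᵢ≢b =
  i , (λ eq → xᵢ≢b (trans eq (lookup∘update i x b))) , λ j j≢i → sym (lookup∘update′ j≢i x b)

hamming-removeAt : ∀ {m} (x y : Vec Bool (suc m)) i
  → hamming x y ≡ bitDistance (lookup x i) (lookup y i) + hamming (removeAt x i) (removeAt y i)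
hamming-removeAt (a ∷ x)     (b ∷ y)     zero    = refl
hamming-removeAt (a ∷ c ∷ x) (b ∷ e ∷ y) (suc i) = begin
  bitDistance a b + hamming (c ∷ x) (e ∷ y)
    ≡⟨ cong (bitDistance a b +_) (hamming-removeAt (c ∷ x) (e ∷ y) i) ⟩
  bitDistance a b + (δ + hamming (removeAt (c ∷ x) i) (removeAt (e ∷ y) i))
    ≡⟨ x∙yz≈y∙xz (bitDistance a b) δ _ ⟩
  δ + (bitDistance a b + hamming (removeAt (c ∷ x) i) (removeAt (e ∷ y) i)) ∎
  where
  open ≡-Reasoning
  δ : ℕ
  δ = bitDistance (lookup (c ∷ x) i) (lookup (e ∷ y) i)

FlipAt : ∀ {d} → Vec Bool d → Vec Bool d → Fin d → Set
FlipAt x y i = lookup x i ≢ lookup y i × (∀ j → j ≢ i → lookup x j ≡ lookup y j)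

flip-sym : ∀ {d} {x y : Vec Bool d} {i} → FlipAt x y i → FlipAt y x i
flip-sym (xᵢ≢yᵢ , agree) = xᵢ≢yᵢ ∘ sym , λ j j≢i → sym (agree j j≢i)

flips-at : ∀ {d} {x y : Vec Bool d} → DifferInOne x y → ∀ {i} → lookup x i ≢ lookup y i
  → FlipAt x y i
flips-at (i₀ , _ , agree) {i} xᵢ≢yᵢ with i₀ ≟ᶠ i
... | yes refl = xᵢ≢yᵢ , agree
... | no  i₀≢i = ⊥-elim (xᵢ≢yᵢ (agree i (i₀≢i ∘ sym)))

edge-sides : ∀ {d} (x y : Vec Bool d) i → FlipAt x y i → (w : Vec Bool d)
  → lookup w i ≡ lookup x i → hamming w y ≡ suc (hamming w x)
edge-sides (a ∷ x) (b ∷ y) zero (a≢b , agree) (c ∷ w) refl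
  rewrite bitDistance-self c | bitDistance-≢ a≢b | vec-ext {x = x} {y} (λ j → agree (suc j) (λ ()))
  = refl
edge-sides (a ∷ x) (b ∷ y) (suc i) (xᵢ≢yᵢ , agree) (c ∷ w) wᵢ≡xᵢ
  rewrite agree zero (λ ()) =
  trans (cong (bitDistance c b +_) (edge-sides x y i (xᵢ≢yᵢ , agree-tail) w wᵢ≡xᵢ)) (+-suc _ _)
  where
  agree-tail : ∀ j → j ≢ i → lookup x j ≡ lookup y j
  agree-tail j j≢i = agree (suc j) (j≢i ∘ suc-injectiveᶠ)

other-side : ∀ {d} {x y w : Vec Bool d} {i} → FlipAt x y i
  → lookup w i ≢ lookup x i → lookup w i ≡ lookup y i
other-side (xᵢ≢yᵢ , _) wᵢ≢xᵢ = trans (¬-not wᵢ≢xᵢ) (sym (¬-not (xᵢ≢yᵢ ∘ sym)))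

semicube-by-distance : ∀ {d} (x y : Vec Bool d) i → FlipAt x y i → (w : Vec Bool d)
  → (lookup w i ≡ lookup x i) ⇔ (hamming w x < hamming w y)
semicube-by-distance x y i flip w = mk⇔ closer on-x-side
  where
  closer : lookup w i ≡ lookup x i → hamming w x < hamming w y
  closer wᵢ≡xᵢ = ≤-reflexive (sym (edge-sides x y i flip w wᵢ≡xᵢ))
  on-x-side : hamming w x < hamming w y → lookup w i ≡ lookup x i
  on-x-side w-closer with lookup w i ≟ᵇ lookup x i
  ... | yes wᵢ≡xᵢ = wᵢ≡xᵢ
  ... | no  wᵢ≢xᵢ = ⊥-elim (<-asym w-closer (≤-reflexive (sym farther)))
    where
    farther : hamming w x ≡ suc (hamming w y)
    farther = edge-sides y x i (flip-sym {x = x} {y} flip) w (other-side {x = x} {y} {w} flip wᵢ≢xᵢ)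

distance-by-geodesics : (H : Graph) (h : V H → V H → ℕ)
  → (∀ {x y m} → Walk H x y m → h x y ≤ m)
  → (∀ x y → h x y ≡ 0 → x ≡ y)
  → (∀ x y {n} → h x y ≡ suc n → Σ (V H) λ z → E H x z × h z y ≡ n)
  → ∀ x y m → Dist H x y m ⇔ (m ≡ h x y)
distance-by-geodesics H h bound coincide closer x y m =
  mk⇔ (λ (walk , shortest) → ≤-antisym (shortest _ (geodesic _ x y refl)) (bound walk))
      (λ { refl → geodesic _ x y refl , λ _ → bound })
  where
  geodesic : ∀ n x y → h x y ≡ n → Walk H x y n
  geodesic zero    x y h≡0 with coincide x y h≡0
  ... | refl = here
  geodesic (suc n) x y h≡n+1 with closer x y h≡n+1
  ... | z , xz , h≡n = step xz (geodesic n z y h≡n)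

edge-step : ∀ {d} {x v : Vec Bool d} → DifferInOne x v → (y : Vec Bool d)
  → hamming x y ≤ suc (hamming v y)
edge-step {x = x} {v} (i , flip) y with lookup y i ≟ᵇ lookup x i
... | yes yᵢ≡xᵢ = begin
  hamming x y         ≡⟨ hamming-sym x y ⟩
  hamming y x         ≤⟨ m≤n⇒m≤1+n ≤-refl ⟩
  suc (hamming y x)   ≡⟨ sym (edge-sides x v i flip y yᵢ≡xᵢ) ⟩
  hamming y v         ≡⟨ hamming-sym y v ⟩
  hamming v y         ≤⟨ m≤n⇒m≤1+n ≤-refl ⟩
  suc (hamming v y)   ∎
  where open ≤-Reasoning
... | no  yᵢ≢xᵢ = ≤-reflexive (begin
  hamming x y         ≡⟨ hamming-sym x y ⟩
  hamming y x         ≡⟨ edge-sides v x i (flip-sym {x = x} {v} flip) y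
                                      (other-side {x = x} {v} {y} flip yᵢ≢xᵢ) ⟩
  suc (hamming y v)   ≡⟨ cong suc (hamming-sym y v) ⟩
  suc (hamming v y)   ∎)
  where open ≡-Reasoning

hamming≤walk : ∀ {d} {x y : Vec Bool d} {m} → Walk (Q d) x y m → hamming x y ≤ m
hamming≤walk {x = x} here = ≤-reflexive (hamming-self x)
hamming≤walk {x = x} {y} (step {v = v} e walk) =
  ≤-trans (edge-step {x = x} {v} e y) (s≤s (hamming≤walk walk))

HammingMetric : ∀ {d} (H : Graph) → (V H → Vec Bool d) → Set
HammingMetric H ℓ = ∀ x y m → Dist H x y m ⇔ (m ≡ hamming (ℓ x) (ℓ y))

distance-Q : ∀ {d} → HammingMetric (Q d) (λ x → x)
distance-Q {d} = distance-by-geodesics (Q d) hamming hamming≤walk (λ _ _ → hamming-zero) closer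
  where
  closer : ∀ x y {n} → hamming x y ≡ suc n → Σ (Vec Bool d) λ z → DifferInOne x z × hamming z y ≡ n
  closer x y h with differing-coordinate x y h
  ... | i , xᵢ≢yᵢ = x [ i ]≔ lookup y i , update-differs x i (lookup y i) xᵢ≢yᵢ
                  , suc-injective (trans (hamming-update x y i xᵢ≢yᵢ) h)

hamming-one : ∀ {d} {x y : Vec Bool d} → hamming x y ≡ 1 → DifferInOne x y
hamming-one {x = x} {y} h with from (distance-Q x y 1) (sym h)
... | step e here , _ = e

fibonacci-tail : ∀ {d} a (x : Vec Bool d) → Fibonacci (a ∷ x) → Fibonacci x
fibonacci-tail false x           fib = fib
fibonacci-tail true  []          _   = tt
fibonacci-tail true  (false ∷ x) fib = fib

-- Membership in Γ_d is a proposition, so vertices of Γ_d are determined by their strings.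
fibonacci-irrelevant : ∀ {d} (x : Vec Bool d) (p q : Fibonacci x) → p ≡ q
fibonacci-irrelevant []                p q = refl
fibonacci-irrelevant (false ∷ x)       p q = fibonacci-irrelevant x p q
fibonacci-irrelevant (true ∷ [])       p q = refl
fibonacci-irrelevant (true ∷ false ∷ x) p q = fibonacci-irrelevant x p q

Γ-vertex-≡ : ∀ {d} {x y : V (Γ d)} → proj₁ x ≡ proj₁ y → x ≡ y
Γ-vertex-≡ {x = x , p} {.x , q} refl = cong (x ,_) (fibonacci-irrelevant x p q)

_≼_ : ∀ {d} → Vec Bool d → Vec Bool d → Set
x ≼ y = ∀ i → lookup x i ≡ true → lookup y i ≡ true

fibonacci-down : ∀ {d} (x y : Vec Bool d) → x ≼ y → Fibonacci y → Fibonacci x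
fibonacci-down []                 []          _   _   = tt
fibonacci-down (false ∷ x)        (b ∷ y)     x≼y fib =
  fibonacci-down x y (x≼y ∘ suc) (fibonacci-tail b y fib)
fibonacci-down (true ∷ [])        _           _   _   = tt
fibonacci-down (true ∷ false ∷ x) (b ∷ c ∷ y) x≼y fib =
  fibonacci-down (false ∷ x) (c ∷ y) (x≼y ∘ suc) (fibonacci-tail b (c ∷ y) fib)
fibonacci-down (true ∷ true ∷ x)  (b ∷ c ∷ y) x≼y fib
  with x≼y zero refl | x≼y (suc zero) refl
... | refl | refl = fib

update-below : ∀ {d} (x z : Vec Bool d) i {b} → (b ≡ true → lookup z i ≡ true) → x ≼ z
  → (x [ i ]≔ b) ≼ z
update-below x z i {b} allowed x≼z j with j ≟ᶠ i
... | yes refl = λ updated → allowed (trans (sym (lookup∘update j x b)) updated)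
... | no  j≢i  = λ updated → x≼z j (trans (sym (lookup∘update′ j≢i x b)) updated)

-- Distance in the Fibonacci cube Γ_d is Hamming distance: flipping a 1 of x
-- that is 0 in y, or else (when x ≼ y) any differing bit, keeps the string
-- Fibonacci and brings it one step closer to y.
distance-Γ : ∀ {d} → HammingMetric (Γ d) proj₁
distance-Γ {d} = distance-by-geodesics (Γ d) (λ x y → hamming (proj₁ x) (proj₁ y)) bound
  (λ _ _ → Γ-vertex-≡ ∘ hamming-zero) closer
  where
  forget : ∀ {x y m} → Walk (Γ d) x y m → Walk (Q d) (proj₁ x) (proj₁ y) m
  forget here          = here
  forget (step e walk) = step e (forget walk)

  bound : ∀ {x y m} → Walk (Γ d) x y m → hamming (proj₁ x) (proj₁ y) ≤ m
  bound = hamming≤walk ∘ forget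

  toward : ∀ (x y : Vec Bool d) {n} → hamming x y ≡ suc n → ∀ i → lookup x i ≢ lookup y i
    → DifferInOne x (x [ i ]≔ lookup y i) × hamming (x [ i ]≔ lookup y i) y ≡ n
  toward x y h i xᵢ≢yᵢ =
    update-differs x i (lookup y i) xᵢ≢yᵢ , suc-injective (trans (hamming-update x y i xᵢ≢yᵢ) h)

  closer : ∀ x y {n} → hamming (proj₁ x) (proj₁ y) ≡ suc n
    → Σ (V (Γ d)) λ z → DifferInOne (proj₁ x) (proj₁ z) × hamming (proj₁ z) (proj₁ y) ≡ n
  closer (x , fx) (y , fy) h with any? (λ i → (lookup x i ≟ᵇ true) ×-dec (lookup y i ≟ᵇ false))
  ... | yes (i , xᵢ≡1 , yᵢ≡0) = (x [ i ]≔ lookup y i , fib) , toward x y h i xᵢ≢yᵢ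
    where
    xᵢ≢yᵢ : lookup x i ≢ lookup y i
    xᵢ≢yᵢ eq with trans (sym xᵢ≡1) (trans eq yᵢ≡0)
    ... | ()
    fib : Fibonacci (x [ i ]≔ lookup y i)
    fib = fibonacci-down (x [ i ]≔ lookup y i) x
            (update-below x x i (λ yᵢ≡1 → ⊥-elim (xᵢ≢yᵢ (trans xᵢ≡1 (sym yᵢ≡1)))) (λ _ p → p)) fx
  ... | no none with differing-coordinate x y h
  ...   | i , xᵢ≢yᵢ = (x [ i ]≔ lookup y i , fib) , toward x y h i xᵢ≢yᵢ
    where
    x≼y : x ≼ y
    x≼y j xⱼ≡1 = ¬-not (λ yⱼ≡0 → none (j , xⱼ≡1 , yⱼ≡0))
    fib : Fibonacci (x [ i ]≔ lookup y i)
    fib = fibonacci-down (x [ i ]≔ lookup y i) y (update-below x y i (λ p → p) x≼y) fy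

fibonacci-no-consecutive-ones : ∀ {d} (x : Vec Bool d) → Fibonacci x → (c c′ : Fin d)
  → toℕ c′ ≡ suc (toℕ c) → lookup x c ≡ true → lookup x c′ ≡ true → ⊥
fibonacci-no-consecutive-ones (a ∷ b ∷ x) fib zero (suc zero) _ refl refl = fib
fibonacci-no-consecutive-ones (a ∷ x) fib (suc c) (suc c′) c′≡c+1 =
  fibonacci-no-consecutive-ones x (fibonacci-tail a x fib) c c′ (suc-injective c′≡c+1)
fibonacci-no-consecutive-ones (a ∷ x) fib zero (suc (suc c′)) ()
fibonacci-no-consecutive-ones (a ∷ x) fib (suc c) zero ()

double : ℕ → ℕ
double zero    = zero
double (suc m) = suc (suc (double m))

pad : ∀ {m} → Vec Bool m → Vec Bool (double m)
pad []      = []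
pad (c ∷ r) = false ∷ c ∷ pad r

hamming-pad : ∀ {m} (r s : Vec Bool m) → hamming (pad r) (pad s) ≡ hamming r s
hamming-pad []      []      = refl
hamming-pad (c ∷ r) (e ∷ s) = cong (bitDistance c e +_) (hamming-pad r s)

fibonacci-pad : ∀ {m} b (r : Vec Bool m) → Fibonacci (b ∷ pad r)
fibonacci-pad false []      = tt
fibonacci-pad true  []      = tt
fibonacci-pad false (c ∷ r) = fibonacci-pad c r
fibonacci-pad true  (c ∷ r) = fibonacci-pad c r

fibonacci-pair : ∀ {m} a b (r : Vec Bool m) → ¬ (a ≡ true × b ≡ true) → Fibonacci (a ∷ b ∷ pad r)
fibonacci-pair false b     r _        = fibonacci-pad b r
fibonacci-pair true  false r _        = fibonacci-pad false r
fibonacci-pair true  true  r not-both = ⊥-elim (not-both (refl , refl))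

-- The least length 2k − 1 of a Fibonacci string carrying k free bits.
sparseLength : ℕ → ℕ
sparseLength zero    = zero
sparseLength (suc m) = suc (double m)

sparseLength≡ : ∀ k → sparseLength k ≡ 2 * k ∸ 1
sparseLength≡ zero    = refl
sparseLength≡ (suc m) = begin
  suc (double m)      ≡⟨ cong suc (double≡ m) ⟩
  suc (m + m)         ≡⟨ sym (+-suc m m) ⟩
  m + suc m           ≡⟨ cong (λ t → m + suc t) (sym (+-identityʳ m)) ⟩
  m + suc (m + 0)     ∎
  where
  open ≡-Reasoning
  double≡ : ∀ m → double m ≡ m + m
  double≡ zero    = refl
  double≡ (suc m) = cong suc (trans (cong suc (double≡ m)) (sym (+-suc m m)))

spread : ∀ {k} → Vec Bool k → Vec Bool (sparseLength k)
spread []      = []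
spread (a ∷ r) = a ∷ pad r

hamming-spread : ∀ {k} (x y : Vec Bool k) → hamming (spread x) (spread y) ≡ hamming x y
hamming-spread []      []      = refl
hamming-spread (a ∷ r) (b ∷ s) = cong (bitDistance a b +_) (hamming-pad r s)

fibonacci-spread : ∀ {k} (x : Vec Bool k) → Fibonacci (spread x)
fibonacci-spread []      = tt
fibonacci-spread (a ∷ r) = fibonacci-pad a r

-- squeeze puts coordinates i and i′ first, complemented so that the pattern
-- (a, b) becomes 11, followed by the other k − 2 coordinates padded by 0s.
squeeze : ∀ {m} {i i′ : Fin (2 + m)} → i ≢ i′ → (a b : Bool) → Vec Bool (2 + m)
  → Vec Bool (2 + double m)
squeeze {i = i} {i′} i≢i′ a b x =
  (not a xor lookup x i) ∷ (not b xor lookup x i′) ∷ pad (removeAt (removeAt x i) (punchOut i≢i′))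

hamming-squeeze : ∀ {m} {i i′ : Fin (2 + m)} (i≢i′ : i ≢ i′) a b (x y : Vec Bool (2 + m))
  → hamming (squeeze i≢i′ a b x) (squeeze i≢i′ a b y) ≡ hamming x y
hamming-squeeze {m} {i} {i′} i≢i′ a b x y = begin
  bitDistance (not a xor xᵢ) (not a xor yᵢ)
    + (bitDistance (not b xor xᵢ′) (not b xor yᵢ′) + hamming (pad rest-x) (pad rest-y))
    ≡⟨ cong₂ _+_ (bitDistance-xor (not a) xᵢ yᵢ)
                 (cong₂ _+_ (bitDistance-xor (not b) xᵢ′ yᵢ′) (hamming-pad rest-x rest-y)) ⟩
  bitDistance xᵢ yᵢ + (bitDistance xᵢ′ yᵢ′ + hamming rest-x rest-y)
    ≡⟨ cong (bitDistance xᵢ yᵢ +_) (sym without-i) ⟩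
  bitDistance xᵢ yᵢ + hamming (removeAt x i) (removeAt y i)
    ≡⟨ sym (hamming-removeAt x y i) ⟩
  hamming x y ∎
  where
  open ≡-Reasoning
  xᵢ yᵢ xᵢ′ yᵢ′ : Bool
  xᵢ = lookup x i
  yᵢ = lookup y i
  xᵢ′ = lookup x i′
  yᵢ′ = lookup y i′
  rest-x rest-y : Vec Bool m
  rest-x = removeAt (removeAt x i) (punchOut i≢i′)
  rest-y = removeAt (removeAt y i) (punchOut i≢i′)
  without-i : hamming (removeAt x i) (removeAt y i) ≡ bitDistance xᵢ′ yᵢ′ + hamming rest-x rest-y
  without-i = trans (hamming-removeAt (removeAt x i) (removeAt y i) (punchOut i≢i′))
                    (cong₂ (λ p q → bitDistance p q + hamming rest-x rest-y)
                           (removeAt-punchOut x i≢i′) (removeAt-punchOut y i≢i′))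

fibonacci-squeeze : ∀ {m} {i i′ : Fin (2 + m)} (i≢i′ : i ≢ i′) a b (x : Vec Bool (2 + m))
  → ¬ (lookup x i ≡ a × lookup x i′ ≡ b) → Fibonacci (squeeze i≢i′ a b x)
fibonacci-squeeze {i = i} {i′} i≢i′ a b x avoids = fibonacci-pair _ _ _
  (λ (first , second) → avoids (not-xor-true a (lookup x i) first , not-xor-true b (lookup x i′) second))

-- k marks fit into ⌈ j /2⌉ pairs of positions only if j ≥ 2k − 1.
sparseLength-bound : ∀ k j → k ≤ ⌈ j /2⌉ → sparseLength k ≤ j
sparseLength-bound zero          j             _          = z≤n
sparseLength-bound (suc zero)    (suc j)       _          = s≤s z≤n
sparseLength-bound (suc (suc m)) (suc (suc j)) (s≤s fits) = s≤s (s≤s (sparseLength-bound (suc m) j fits))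
sparseLength-bound (suc zero)    zero          ()
sparseLength-bound (suc (suc m)) zero          ()
sparseLength-bound (suc (suc m)) (suc zero)    (s≤s ())

same-half : ∀ p q → ⌊ p /2⌋ ≡ ⌊ q /2⌋ → p ≡ q ⊎ q ≡ suc p ⊎ p ≡ suc q
same-half zero          zero          _ = inj₁ refl
same-half zero          (suc zero)    _ = inj₂ (inj₁ refl)
same-half (suc zero)    zero          _ = inj₂ (inj₂ refl)
same-half (suc zero)    (suc zero)    _ = inj₁ refl
same-half (suc (suc p)) (suc (suc q)) halves with same-half p q (suc-injective halves)
... | inj₁ p≡q          = inj₁ (cong (2 +_) p≡q)
... | inj₂ (inj₁ q≡p+1) = inj₂ (inj₁ (cong (2 +_) q≡p+1))
... | inj₂ (inj₂ p≡q+1) = inj₂ (inj₂ (cong (2 +_) p≡q+1))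
same-half zero          (suc (suc q)) ()
same-half (suc zero)    (suc (suc q)) ()
same-half (suc (suc p)) zero          ()
same-half (suc (suc p)) (suc zero)    ()

Sparse : ∀ {k j} → (Fin k → Fin j) → Set
Sparse σ = ∀ i i′ → i ≢ i′ → toℕ (σ i) ≢ toℕ (σ i′) × toℕ (σ i′) ≢ suc (toℕ (σ i))

-- Halving positions is injective on sparse marks, hence 2k − 1 ≤ j.
sparse-bound : ∀ {k j} (σ : Fin k → Fin j) → Sparse σ → sparseLength k ≤ j
sparse-bound {k} {j} σ sparse = sparseLength-bound k j (injective⇒≤ halves-injective)
  where
  half : Fin k → Fin ⌈ j /2⌉
  half i = fromℕ< (⌊n/2⌋-mono (s≤s (toℕ<n (σ i))))
  halves-injective : Injective _≡_ _≡_ half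
  halves-injective {i} {i′} halves with i ≟ᶠ i′
  ... | yes i≡i′ = i≡i′
  ... | no  i≢i′ with same-half (toℕ (σ i)) (toℕ (σ i′))
                                (trans (sym (toℕ-fromℕ< _)) (trans (cong toℕ halves) (toℕ-fromℕ< _)))
  ...   | inj₁ equal          = ⊥-elim (proj₁ (sparse i i′ i≢i′) equal)
  ...   | inj₂ (inj₁ next)    = ⊥-elim (proj₂ (sparse i i′ i≢i′) next)
  ...   | inj₂ (inj₂ previous) = ⊥-elim (proj₂ (sparse i′ i (i≢i′ ∘ sym)) previous)

adjacent-distance : ∀ {n} (G : FiniteSimpleGraph n) {a b} → Adj G a b → Dist (toGraph G) a b 1
adjacent-distance G {a} {b} ab = step ab here , shortest
  where
  shortest : ∀ m → Walk (toGraph G) a b m → 1 ≤ m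
  shortest zero    here = ⊥-elim (Adj-irrefl G ab)
  shortest (suc m) _    = s≤s z≤n

walk-crosses : ∀ {H : Graph} (colour : V H → Bool) {u v m} → Walk H u v m → colour u ≢ colour v
  → Σ (V H) λ a → Σ (V H) λ b → E H a b × colour a ≢ colour b
walk-crosses colour here u≢u = ⊥-elim (u≢u refl)
walk-crosses colour {u} (step {v = w} uw walk) u≢v with colour u ≟ᵇ colour w
... | no  u≢w = u , w , uw , u≢w
... | yes u≡w = walk-crosses colour walk (u≢v ∘ trans u≡w)

module Reference {n} (G : FiniteSimpleGraph n) {k} (β : Fin n → Vec Bool k)
  (β-injective : Injective _≡_ _≡_ β) (β-isometric : DistancePreserving (toGraph G) (Q k) β) where

  distance-G : HammingMetric (toGraph G) β
  distance-G u v m = mk⇔ (to (distance-Q (β u) (β v) m) ∘ to (β-isometric u v m))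
                         (from (β-isometric u v m) ∘ from (distance-Q (β u) (β v) m))

  Faithful : ∀ {d} → (Fin n → Vec Bool d) → Set
  Faithful g = ∀ u v → hamming (g u) (g v) ≡ hamming (β u) (β v)

  embedding-from-faithful : ∀ {d} (H : Graph) (ℓ : V H → Vec Bool d) → HammingMetric H ℓ
    → (f : Fin n → V H) → Faithful (ℓ ∘ f) → IsometricEmbedding (toGraph G) H
  embedding-from-faithful H ℓ metric f faithful = f , injective , isometric
    where
    injective : Injective _≡_ _≡_ f
    injective {u} {v} fu≡fv = β-injective (hamming-zero (begin
      hamming (β u) (β v)           ≡⟨ sym (faithful u v) ⟩
      hamming (ℓ (f u)) (ℓ (f v))   ≡⟨ cong (λ t → hamming (ℓ (f u)) (ℓ t)) (sym fu≡fv) ⟩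
      hamming (ℓ (f u)) (ℓ (f u))   ≡⟨ hamming-self (ℓ (f u)) ⟩
      0                             ∎))
      where open ≡-Reasoning
    isometric : DistancePreserving (toGraph G) H f
    isometric u v m =
      mk⇔ (λ D → from (metric (f u) (f v) m) (trans (to (distance-G u v m) D) (sym (faithful u v))))
          (λ D → from (distance-G u v m) (trans (to (metric (f u) (f v) m) D) (faithful u v)))

  faithful-from-embedding : ∀ {d} (H : Graph) (ℓ : V H → Vec Bool d) → HammingMetric H ℓ
    → (e : IsometricEmbedding (toGraph G) H) → Faithful (ℓ ∘ proj₁ e)
  faithful-from-embedding H ℓ metric (f , _ , isometric) u v =
    sym (to (metric (f u) (f v) _) (to (isometric u v _) (from (distance-G u v _) refl)))

  faithful-edge : ∀ {d} {g : Fin n → Vec Bool d} → Faithful g → ∀ {a b} → Adj G a b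
    → DifferInOne (g a) (g b)
  faithful-edge {g = g} faithful {a} {b} ab =
    hamming-one {x = g a} {g b} (trans (faithful a b) (sym (to (distance-G a b 1) (adjacent-distance G ab))))

  Tracks : ∀ {d} → (Fin n → Vec Bool d) → Fin d → Fin k → Set
  Tracks g c i = Σ Bool λ o → ∀ w → lookup (g w) c ≡ o xor lookup (β w) i

  -- Θ-classes are preserved: if coordinate i of β is not constant, a faithful g
  -- has a coordinate tracking it, namely the one flipped by any edge flipping i;
  -- both coordinates cut G into the two sides of that edge.
  tracking : ∀ {d} {g : Fin n → Vec Bool d} → Faithful g → ∀ i {u₀ u₁}
    → lookup (β u₀) i ≢ lookup (β u₁) i → Σ (Fin d) λ c → Tracks g c i
  tracking {d} {g} faithful i {u₀} {u₁} u₀≢u₁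
    with walk-crosses (λ w → lookup (β w) i) (proj₁ (from (distance-G u₀ u₁ _) refl)) u₀≢u₁
  ... | a , b , ab , aᵢ≢bᵢ = c , lookup (g a) c xor lookup (β a) i , λ w → aligned (same-side w)
    where
    flipβ : FlipAt (β a) (β b) i
    flipβ = flips-at {x = β a} {β b} (faithful-edge {g = β} (λ _ _ → refl) ab) aᵢ≢bᵢ
    c : Fin d
    c = proj₁ (faithful-edge {g = g} faithful ab)
    flipg : FlipAt (g a) (g b) c
    flipg = proj₂ (faithful-edge {g = g} faithful ab)
    same-side : ∀ w → (lookup (β w) i ≡ lookup (β a) i) ⇔ (lookup (g w) c ≡ lookup (g a) c)
    same-side w = ⇔-sym (subst₂ (λ p q → (lookup (g w) c ≡ lookup (g a) c) ⇔ (p < q))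
                                (faithful w a) (faithful w b)
                                (semicube-by-distance (g a) (g b) c flipg (g w)))
                  ⇔-∘ semicube-by-distance (β a) (β b) i flipβ (β w)

  quadrant : ∀ {i i′} → Crossing β i i′ → ∀ a b → ∃ λ u → lookup (β u) i ≡ a × lookup (β u) i′ ≡ b
  quadrant (_ , q , _ , _ , _) false false = q
  quadrant (_ , _ , q , _ , _) false true  = q
  quadrant (_ , _ , _ , q , _) true  false = q
  quadrant (_ , _ , _ , _ , q) true  true  = q

  -- Crossing Θ-classes are tracked by different coordinates: two vertices on
  -- the same side of i but on different sides of i′ would otherwise agree at c.
  tracked-apart : ∀ {d} {g : Fin n → Vec Bool d} {c i i′} → Tracks g c i → Tracks g c i′
    → Crossing β i i′ → ⊥
  tracked-apart {g = g} {c} {i} {i′} (o , track) (o′ , track′) crossing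
    with quadrant crossing false false | quadrant crossing false true
  ... | w₁ , w₁ᵢ , w₁ᵢ′ | w₂ , w₂ᵢ , w₂ᵢ′ = false≢true (xor-injective o′ (begin
    o′ xor false             ≡⟨ cong (o′ xor_) (sym w₁ᵢ′) ⟩
    o′ xor lookup (β w₁) i′  ≡⟨ sym (track′ w₁) ⟩
    lookup (g w₁) c          ≡⟨ track w₁ ⟩
    o xor lookup (β w₁) i    ≡⟨ cong (o xor_) (trans w₁ᵢ (sym w₂ᵢ)) ⟩
    o xor lookup (β w₂) i    ≡⟨ sym (track w₂) ⟩
    lookup (g w₂) c          ≡⟨ track′ w₂ ⟩
    o′ xor lookup (β w₂) i′  ≡⟨ cong (o′ xor_) w₂ᵢ′ ⟩
    o′ xor true              ∎))
    where
    open ≡-Reasoning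
    false≢true : false ≢ true
    false≢true ()

  -- For a Fibonacci labelling, crossing Θ-classes are not tracked by
  -- consecutive coordinates: some vertex has 1s at both tracking coordinates.
  tracked-consecutive : ∀ {d} {g : Fin n → Vec Bool d} → (∀ w → Fibonacci (g w))
    → ∀ {c c′ i i′} → Tracks g c i → Tracks g c′ i′ → Crossing β i i′
    → toℕ c′ ≢ suc (toℕ c)
  tracked-consecutive {g = g} fibonacci {c} {c′} (o , track) (o′ , track′) crossing c′≡c+1
    with quadrant crossing (not o) (not o′)
  ... | w , wᵢ , wᵢ′ =
    fibonacci-no-consecutive-ones (g w) (fibonacci w) c c′ c′≡c+1 (one track wᵢ) (one track′ wᵢ′)
    where
    one : ∀ {c i o} → (∀ w → lookup (g w) c ≡ o xor lookup (β w) i) → lookup (β w) i ≡ not o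
      → lookup (g w) c ≡ true
    one {o = o} track wᵢ≡¬o = trans (track w) (trans (cong (o xor_) wᵢ≡¬o) (xor-not-self o))

  spread-embedding : IsometricEmbedding (toGraph G) (Γ (sparseLength k))
  spread-embedding = embedding-from-faithful (Γ (sparseLength k)) proj₁ distance-Γ
    (λ u → spread (β u) , fibonacci-spread (β u)) (λ u v → hamming-spread (β u) (β v))

-- In an embedding of minimal dimension every coordinate takes both values:
-- a constant coordinate could be deleted, giving an embedding into Q_{k−1}.
semicubes-nonempty : ∀ {n} (G : FiniteSimpleGraph n) {k} (β : Fin n → Vec Bool k)
  (β-injective : Injective _≡_ _≡_ β) (β-isometric : DistancePreserving (toGraph G) (Q k) β)
  → IsIdim (toGraph G) k → ∀ i b → ∃ λ u → lookup (β u) i ≡ b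
semicubes-nonempty G {zero} β _ _ _ () b
semicubes-nonempty G {suc k} β β-injective β-isometric (_ , minimal) i b
  with any? (λ u → lookup (β u) i ≟ᵇ b)
... | yes found = found
... | no  none  = ⊥-elim (1+n≰n (minimal k shorter))
  where
  open Reference G β β-injective β-isometric
  constant : ∀ u v → lookup (β u) i ≡ lookup (β v) i
  constant u v = trans (¬-not (λ uᵢ≡b → none (u , uᵢ≡b))) (sym (¬-not (λ vᵢ≡b → none (v , vᵢ≡b))))
  deleted : Faithful (λ u → removeAt (β u) i)
  deleted u v = begin
    hamming (removeAt (β u) i) (removeAt (β v) i)
      ≡⟨ cong (_+ hamming (removeAt (β u) i) (removeAt (β v) i)) (sym no-difference) ⟩
    bitDistance (lookup (β u) i) (lookup (β v) i) + hamming (removeAt (β u) i) (removeAt (β v) i)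
      ≡⟨ sym (hamming-removeAt (β u) (β v) i) ⟩
    hamming (β u) (β v) ∎
    where
    open ≡-Reasoning
    no-difference : bitDistance (lookup (β u) i) (lookup (β v) i) ≡ 0
    no-difference = trans (cong (bitDistance (lookup (β u) i)) (sym (constant u v))) (bitDistance-self _)
  shorter : IsometricEmbedding (toGraph G) (Q k)
  shorter = embedding-from-faithful (Q k) (λ x → x) distance-Q (λ u → removeAt (β u) i) deleted

-- If G^# is complete, every Fibonacci embedding has at least 2k − 1 coordinates:
-- the coordinates tracking the k Θ-classes are distinct and never consecutive.
fibonacci-lower-bound : ∀ {n} (G : FiniteSimpleGraph n) {k} (β : Fin n → Vec Bool k)
  (β-injective : Injective _≡_ _≡_ β) (β-isometric : DistancePreserving (toGraph G) (Q k) β)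
  → IsIdim (toGraph G) k → CrossingGraphComplete β
  → ∀ j → IsometricEmbedding (toGraph G) (Γ j) → sparseLength k ≤ j
fibonacci-lower-bound {n} G {k} β β-injective β-isometric idim complete j e = sparse-bound σ sparse
  where
  open Reference G β β-injective β-isometric
  g : Fin n → Vec Bool j
  g = proj₁ ∘ proj₁ e
  track : ∀ i → Σ (Fin j) λ c → Tracks g c i
  track i with semicubes-nonempty G β β-injective β-isometric idim i false
             | semicubes-nonempty G β β-injective β-isometric idim i true
  ... | u₀ , u₀ᵢ≡0 | u₁ , u₁ᵢ≡1 =
    tracking {g = g} (faithful-from-embedding (Γ j) proj₁ distance-Γ e) i
             (λ same → not-¬ u₀ᵢ≡0 (trans same u₁ᵢ≡1))
  σ : Fin k → Fin j
  σ i = proj₁ (track i)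
  sparse : Sparse σ
  sparse i i′ i≢i′ =
    distinct , tracked-consecutive {g = g} (proj₂ ∘ proj₁ e) (proj₂ (track i)) (proj₂ (track i′)) crossing
    where
    crossing : Crossing β i i′
    crossing = complete i i′ i≢i′
    distinct : toℕ (σ i) ≢ toℕ (σ i′)
    distinct same = tracked-apart {g = g} (proj₂ (track i))
      (subst (λ c → Tracks g c i′) (sym (toℕ-injective same)) (proj₂ (track i′))) crossing

-- If no Fibonacci embedding is shorter than 2k − 1, all Θ-classes cross: an
-- empty quadrant of i ≠ i′ would let squeeze embed G into Γ_{2k−2}.
crossing-complete : ∀ {n} (G : FiniteSimpleGraph n) {k} (β : Fin n → Vec Bool k)
  (β-injective : Injective _≡_ _≡_ β) (β-isometric : DistancePreserving (toGraph G) (Q k) β)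
  → (∀ j → IsometricEmbedding (toGraph G) (Γ j) → sparseLength k ≤ j) → CrossingGraphComplete β
crossing-complete G {zero}     β _ _ _ () _
crossing-complete G {suc zero} β _ _ _ zero zero i≢i = ⊥-elim (i≢i refl)
crossing-complete G {suc (suc m)} β β-injective β-isometric minimal i i′ i≢i′ =
  i≢i′ , occupied false false , occupied false true , occupied true false , occupied true true
  where
  open Reference G β β-injective β-isometric
  occupied : ∀ a b → ∃ λ u → lookup (β u) i ≡ a × lookup (β u) i′ ≡ b
  occupied a b with any? (λ u → (lookup (β u) i ≟ᵇ a) ×-dec (lookup (β u) i′ ≟ᵇ b))
  ... | yes found = found
  ... | no  empty = ⊥-elim (1+n≰n (minimal (2 + double m) squeezed))
    where
    squeezed : IsometricEmbedding (toGraph G) (Γ (2 + double m))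
    squeezed = embedding-from-faithful (Γ (2 + double m)) proj₁ distance-Γ
      (λ u → squeeze i≢i′ a b (β u)
           , fibonacci-squeeze i≢i′ a b (β u) (λ shows-pattern → empty (u , shows-pattern)))
      (λ u v → hamming-squeeze i≢i′ a b (β u) (β v))

corollary3p4 : (n : ℕ) (G : FiniteSimpleGraph n) → PartialCube (toGraph G)
    → (k : ℕ) → IsIdim (toGraph G) k
    → (β : V (toGraph G) → Vec Bool k)
    → Injective _≡_ _≡_ β → DistancePreserving (toGraph G) (Q k) β
    → (IsFdim (toGraph G) (2 * k ∸ 1) ⇔ CrossingGraphComplete β)
corollary3p4 n G _ k idim β β-injective β-isometric = mk⇔ from-fdim to-fdim
  where
  open Reference G β β-injective β-isometric
  from-fdim : IsFdim (toGraph G) (2 * k ∸ 1) → CrossingGraphComplete β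
  from-fdim (_ , minimal) = crossing-complete G β β-injective β-isometric
    (λ j e → subst (_≤ j) (sym (sparseLength≡ k)) (minimal j e))
  to-fdim : CrossingGraphComplete β → IsFdim (toGraph G) (2 * k ∸ 1)
  to-fdim complete = subst (IsFdim (toGraph G)) (sparseLength≡ k)
    (spread-embedding , fibonacci-lower-bound G β β-injective β-isometric idim complete)
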